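{- For every integer $n\ge 1$, $Z_{(1)}(P_n \Box P_n) = n$, where $P_n\Box P_n$ is the Cartesian product of two paths on $n$ vertices.
   Context: Let $G=(V,E)$ be a finite simple graph. Color-change rule (zero forcing): given a set of colored vertices, a colored vertex with exactly one uncolored neighbor colors ("forces") that neighbor. Leaks: for a set $L\subseteq V$, placing a leak on each $v\in L$ means attaching to $v$ one new pendant vertex (adjacent only to $v$) which is never initially colored; consequently no vertex of $L$ can ever force a vertex of $V$. A set $S\subseteq V$ is an $\ell$-forcing set if for every $L\subseteq V$ with $|L|\le \ell$, starting with exactly the vertices of $S$ colored and repeatedly applying the color-change rule in the graph with leaks on $L$, every vertex of $V$ eventually becomes colored. $Z_{(\ell)}(G)$ is the minimum size of an $\ell$-forcing set. The Cartesian product $G\Box H$ has vertex set $V(G)\times V(H)$, with $(x,y)\sim(x',y')$ iff ($x=x'$ and $y\sim y'$ in $H$) or ($y=y'$ and $x\sim x'$ in $G$). -}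

module Defs where

open import Data.Nat using (ℕ; suc; _+_; _*_; _≤_)
open import Data.Fin using (Fin; toℕ; remQuot)
open import Data.Fin.Subset using (Subset; _∈_; _∉_; ∣_∣)
open import Data.Product using (_×_; proj₁; proj₂; Σ; _,_)
open import Data.Sum using (_⊎_)
open import Relation.Nullary using (¬_)
open import Relation.Binary.PropositionalEquality using (_≡_; refl)
import Relation.Binary.PropositionalEquality as Eq
open import Data.Sum using (inj₁; inj₂)
open import Data.Nat.Properties using (1+n≢n)

record Graph : Set₁ where
  field
    N     : ℕ
    Adj   : Fin N → Fin N → Set
    irrefl : ∀ x → ¬ Adj x x
    sym   : ∀ x y → Adj x y → Adj y x
open Graph public

PathAdj : (n : ℕ) → Fin n → Fin n → Set
PathAdj n i j = (suc (toℕ i) ≡ toℕ j) ⊎ (suc (toℕ j) ≡ toℕ i)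

BoxAdj : {A B : Set} → (A → A → Set) → (B → B → Set) → A × B → A × B → Set
BoxAdj AdjG AdjH (x , y) (x' , y') =
  ((x ≡ x') × AdjH y y') ⊎ ((y ≡ y') × AdjG x x')

PathGraph : ℕ → Graph
PathGraph n = record { N = n ; Adj = PathAdj n ; irrefl = irr ; sym = sy }
  where
  irr : ∀ x → ¬ PathAdj n x x
  irr x (inj₁ e) = 1+n≢n e
  irr x (inj₂ e) = 1+n≢n e
  sy : ∀ x y → PathAdj n x y → PathAdj n y x
  sy x y (inj₁ e) = inj₂ e
  sy x y (inj₂ e) = inj₁ e

_□_ : Graph → Graph → Graph
G □ H = record { N = N G * N H ; Adj = A ; irrefl = irr ; sym = sy }
  where
  A : Fin (N G * N H) → Fin (N G * N H) → Set
  A a b = BoxAdj (Adj G) (Adj H) (remQuot (N H) a) (remQuot (N H) b)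
  irr : ∀ x → ¬ A x x
  irr x (inj₁ (_ , h)) = irrefl H _ h
  irr x (inj₂ (_ , g)) = irrefl G _ g
  sy : ∀ x y → A x y → A y x
  sy x y (inj₁ (e , h)) = inj₁ (Eq.sym e , sym H _ _ h)
  sy x y (inj₂ (e , g)) = inj₂ (Eq.sym e , sym G _ _ g)

-- The final coloring of the zero forcing process in G with leaks on L,
-- starting from S.  It is the closure of S under the color-change rule:
-- a colored, non-leaked vertex u all of whose neighbors other than v are
-- colored forces its neighbor v.  (A leaked vertex u always has the
-- uncolored pendant neighbor, so it can never force a vertex of V.)
data Colored (G : Graph) (L S : Subset (N G)) : Fin (N G) → Set where
  initial : ∀ {v} → v ∈ S → Colored G L S v
  force   : ∀ {u v} → u ∉ L → Colored G L S u → Adj G u v →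
            (∀ w → Adj G u w → ¬ (w ≡ v) → Colored G L S w) →
            Colored G L S v

IsLeakyForcingSet : (G : Graph) → ℕ → Subset (N G) → Set
IsLeakyForcingSet G ℓ S =
  ∀ (L : Subset (N G)) → ∣ L ∣ ≤ ℓ → ∀ v → Colored G L S v

ZLeak≡ : Graph → ℕ → ℕ → Set
ZLeak≡ G ℓ k =
  Σ (Subset (N G)) (λ S → IsLeakyForcingSet G ℓ S × ∣ S ∣ ≡ k)
  × (∀ S → IsLeakyForcingSet G ℓ S → k ≤ ∣ S ∣)

-- The staircase (0,0), (0,1), (1,1), (1,2), … of n cells along the diagonal is
-- 1-leaky forcing: whichever side of the diagonal the leak lies on, the closed
-- triangle on the other side is forced from the staircase by line sweeps, and
-- from that triangle the rest of the grid by sweeping rows above the leak and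
-- columns below it.
-- Conversely, during any forcing process the active vertices (coloured, with an
-- uncoloured neighbour) never outnumber the initial set, because each force
-- hands activity from the forcer to its target. Just before the first full row
-- (say) appears, every column contains an active vertex, and these are
-- distinct, so every forcing set, leaky or not, has at least n vertices.

module Submission where

open import Defs hiding (sym)
open import Data.Nat using (ℕ; zero; suc; _+_; _*_; _∸_; _≤_; _<_; z≤n; s≤s; _≤?_; s≤s⁻¹; ⌊_/2⌋; ⌈_/2⌉)
open import Data.Nat.Properties
open import Data.Fin using (Fin; zero; suc; toℕ; fromℕ<; combine; remQuot)
import Data.Fin.Properties as Finₚ
open import Data.Fin.Properties using (¬Fin0; ¬∀⟶∃¬; toℕ-injective; toℕ<n; toℕ-fromℕ<; remQuot-combine; combine-remQuot; all?; any?)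
  renaming (_≟_ to _≟ᶠ_)
open import Data.Fin.Subset using (Subset; _∈_; _∉_; ∣_∣; ⊥; ⁅_⁆; _∪_; _∩_; ∁; _⊆_; inside; outside)
open import Data.Fin.Subset.Properties
  using (_∈?_; ∣⊥∣≡0; x∈⁅x⁆; x∈⁅y⁆⇒x≡y; x≢y⇒x∉⁅y⁆; x∈p∪q⁺; x∈p∪q⁻; x∈p∩q⁺; x∈p∩q⁻; x∉p⇒x∈∁p; x∈∁p⇒x∉p; Empty-unique; nonempty?; ⊆-trans)
open import Data.List using (List; []; _∷_; allFin; filter)
open import Data.List.Membership.Propositional using () renaming (_∈_ to _∈ₗ_)
open import Data.List.Membership.Propositional.Properties using (∈-allFin; ∈-filter⁺; ∈-filter⁻)
open import Data.List.Relation.Unary.Any using (here; there)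
open import Data.Vec using ([]; _∷_; here; there; tabulate)
open import Data.Vec.Properties using (lookup⇒[]=; []=⇒lookup; lookup∘tabulate)
open import Data.Product using (_×_; _,_; proj₁; proj₂; ∃-syntax)
open import Data.Sum using (_⊎_; inj₁; inj₂)
import Data.Sum as Sum
import Data.Product as Product
open import Data.Empty using (⊥-elim)
open import Data.Unit using (⊤; tt)
open import Function using (_∘_; const)
open import Function.Definitions using (Injective)
open import Relation.Nullary using (¬_; Dec; yes; no; does)
open import Relation.Nullary.Decidable using (_×-dec_; _⊎-dec_; ¬?; _→-dec_; dec-true; decidable-stable)
open import Relation.Unary using (Decidable)
open import Relation.Binary.PropositionalEquality using (_≡_; _≢_; refl; sym; trans; cong; cong₂; subst; subst₂; module ≡-Reasoning)

module _ {m : ℕ} where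

  _∖_ : Subset m → Fin m → Subset m
  p ∖ x = p ∩ ∁ ⁅ x ⁆

  x∈p∖y⁺ : ∀ {p x y} → x ∈ p → x ≢ y → x ∈ p ∖ y
  x∈p∖y⁺ x∈p x≢y = x∈p∩q⁺ (x∈p , x∉p⇒x∈∁p (x≢y⇒x∉⁅y⁆ x≢y))

  x∈p∖y⁻ : ∀ {p x} y → x ∈ p ∖ y → x ∈ p × x ≢ y
  x∈p∖y⁻ {p} y x∈p∖y with x∈p∩q⁻ p _ x∈p∖y
  ... | x∈p , x∈∁⁅y⁆ = x∈p , λ { refl → x∈∁p⇒x∉p x∈∁⁅y⁆ (x∈⁅x⁆ y) }

∣p∩∁⊥∣≡∣p∣ : ∀ {m} (p : Subset m) → ∣ p ∩ ∁ ⊥ ∣ ≡ ∣ p ∣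
∣p∩∁⊥∣≡∣p∣ []            = refl
∣p∩∁⊥∣≡∣p∣ (inside  ∷ p) = cong suc (∣p∩∁⊥∣≡∣p∣ p)
∣p∩∁⊥∣≡∣p∣ (outside ∷ p) = ∣p∩∁⊥∣≡∣p∣ p

∣p∣≡1+∣p∖x∣ : ∀ {m} {p : Subset m} {x} → x ∈ p → ∣ p ∣ ≡ suc ∣ p ∖ x ∣
∣p∣≡1+∣p∖x∣ {p = inside  ∷ p} here      = cong suc (sym (∣p∩∁⊥∣≡∣p∣ p))
∣p∣≡1+∣p∖x∣ {p = inside  ∷ p} (there x∈p) = cong suc (∣p∣≡1+∣p∖x∣ x∈p)
∣p∣≡1+∣p∖x∣ {p = outside ∷ p} (there x∈p) = ∣p∣≡1+∣p∖x∣ x∈p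

∣p∣≤1+∣p∖x∣ : ∀ {m} (p : Subset m) x → ∣ p ∣ ≤ suc ∣ p ∖ x ∣
∣p∣≤1+∣p∖x∣ (inside  ∷ p) zero    = s≤s (≤-reflexive (sym (∣p∩∁⊥∣≡∣p∣ p)))
∣p∣≤1+∣p∖x∣ (outside ∷ p) zero    = ≤-trans (≤-reflexive (sym (∣p∩∁⊥∣≡∣p∣ p))) (n≤1+n _)
∣p∣≤1+∣p∖x∣ (inside  ∷ p) (suc x) = s≤s (∣p∣≤1+∣p∖x∣ p x)
∣p∣≤1+∣p∖x∣ (outside ∷ p) (suc x) = ∣p∣≤1+∣p∖x∣ p x

module _ {m : ℕ} where

  injective⇒≤∣p∣ : ∀ {k} (p : Subset m) (f : Fin k → Fin m) →
                   Injective _≡_ _≡_ f → (∀ i → f i ∈ p) → k ≤ ∣ p ∣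
  injective⇒≤∣p∣ {zero}  p f _     _   = z≤n
  injective⇒≤∣p∣ {suc k} p f f-inj f∈p = begin
    suc k              ≤⟨ s≤s (injective⇒≤∣p∣ (p ∖ f zero) (f ∘ suc) (Finₚ.suc-injective ∘ f-inj) f∘suc∈p∖f0) ⟩
    suc ∣ p ∖ f zero ∣ ≡⟨ ∣p∣≡1+∣p∖x∣ (f∈p zero) ⟨
    ∣ p ∣              ∎
    where
    open ≤-Reasoning
    f∘suc∈p∖f0 : ∀ i → f (suc i) ∈ p ∖ f zero
    f∘suc∈p∖f0 i = x∈p∖y⁺ (f∈p (suc i)) (λ e → 0≢1+n (sym (cong toℕ (f-inj e))))

  covered⇒∣p∣≤ : ∀ {k} (p : Subset m) (f : Fin k → Fin m) →
                 (∀ {x} → x ∈ p → ∃[ i ] f i ≡ x) → ∣ p ∣ ≤ k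
  covered⇒∣p∣≤ {zero}  p f cover = ≤-reflexive (trans (cong ∣_∣ (Empty-unique (λ (x , x∈p) → ¬Fin0 (proj₁ (cover x∈p))))) (∣⊥∣≡0 m))
  covered⇒∣p∣≤ {suc k} p f cover =
    ≤-trans (∣p∣≤1+∣p∖x∣ p (f zero)) (s≤s (covered⇒∣p∣≤ (p ∖ f zero) (f ∘ suc) cover′))
    where
    cover′ : ∀ {x} → x ∈ p ∖ f zero → ∃[ i ] f (suc i) ≡ x
    cover′ x∈p∖f0 with x∈p∖y⁻ (f zero) x∈p∖f0
    ... | x∈p , x≢f0 with cover x∈p
    ...   | zero  , f0≡x = ⊥-elim (x≢f0 (sym f0≡x))
    ...   | suc i , fi≡x = i , fi≡x

  ∣p∣≤1⇒unique : ∀ {p : Subset m} → ∣ p ∣ ≤ 1 → ∀ {x y} → x ∈ p → y ∈ p → x ≡ y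
  ∣p∣≤1⇒unique {p} ∣p∣≤1 {x} {y} x∈p y∈p with x ≟ᶠ y
  ... | yes x≡y = x≡y
  ... | no  x≢y = ⊥-elim (≤⇒≯ ∣p∣≤1 (begin-strict
    1                ≤⟨ injective⇒≤∣p∣ (p ∖ x) (λ _ → y) (λ { {zero} {zero} _ → refl })
                                       (λ _ → x∈p∖y⁺ y∈p (x≢y ∘ sym)) ⟩
    ∣ p ∖ x ∣        <⟨ n<1+n _ ⟩
    suc ∣ p ∖ x ∣    ≡⟨ ∣p∣≡1+∣p∖x∣ x∈p ⟨
    ∣ p ∣            ∎))
    where open ≤-Reasoning

  x∈p∪⁅y⁆⁻ : ∀ {p : Subset m} {x y} → x ∈ p ∪ ⁅ y ⁆ → x ≢ y → x ∈ p
  x∈p∪⁅y⁆⁻ {p} {y = y} x∈p∪⁅y⁆ x≢y with x∈p∪q⁻ p ⁅ y ⁆ x∈p∪⁅y⁆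
  ... | inj₁ x∈p    = x∈p
  ... | inj₂ x∈⁅y⁆ = ⊥-elim (x≢y (x∈⁅y⁆⇒x≡y y x∈⁅y⁆))

crossing : ∀ {p} {P : ℕ → Set p} → Decidable P →
           ∀ {a b} → a ≤ b → P a → ¬ P b → ∃[ t ] t < b × P t × ¬ P (suc t)
crossing P? {b = zero}  z≤n Pa ¬P0 = ⊥-elim (¬P0 Pa)
crossing P? {b = suc b} a≤1+b Pa ¬P1+b with P? b
... | yes Pb = b , n<1+n b , Pb , ¬P1+b
... | no ¬Pb with m≤n⇒m<n∨m≡n a≤1+b
...   | inj₂ refl = ⊥-elim (¬P1+b Pa)
...   | inj₁ a<1+b with crossing P? (s≤s⁻¹ a<1+b) Pa ¬Pb
...     | t , t<b , Pt , ¬P1+t = t , m<n⇒m<1+n t<b , Pt , ¬P1+t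

subset : ∀ {m p} {P : Fin m → Set p} → Decidable P → Subset m
subset P? = tabulate (does ∘ P?)

∈-subset⁺ : ∀ {m p} {P : Fin m → Set p} (P? : Decidable P) {x} → P x → x ∈ subset P?
∈-subset⁺ P? {x} Px = lookup⇒[]= x _ (trans (lookup∘tabulate _ x) (dec-true (P? x) Px))

∈-subset⁻ : ∀ {m p} {P : Fin m → Set p} (P? : Decidable P) {x} → x ∈ subset P? → P x
∈-subset⁻ P? {x} x∈ with P? x | trans (sym (lookup∘tabulate (does ∘ P?) x)) ([]=⇒lookup x∈)
... | yes Px | _  = Px
... | no  _  | ()

⌈n/2⌉≡⌊n/2⌋⊎1+⌊n/2⌋ : ∀ k → ⌈ k /2⌉ ≡ ⌊ k /2⌋ ⊎ ⌈ k /2⌉ ≡ suc ⌊ k /2⌋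
⌈n/2⌉≡⌊n/2⌋⊎1+⌊n/2⌋ zero          = inj₁ refl
⌈n/2⌉≡⌊n/2⌋⊎1+⌊n/2⌋ (suc zero)    = inj₂ refl
⌈n/2⌉≡⌊n/2⌋⊎1+⌊n/2⌋ (suc (suc k)) = Sum.map (cong suc) (cong suc) (⌈n/2⌉≡⌊n/2⌋⊎1+⌊n/2⌋ k)

⌊i+j/2⌋≡i : ∀ i {j} → j ≡ i ⊎ j ≡ suc i → ⌊ i + j /2⌋ ≡ i
⌊i+j/2⌋≡i i (inj₁ refl) = sym (n≡⌊n+n/2⌋ i)
⌊i+j/2⌋≡i i (inj₂ refl) = begin
  ⌊ i + suc i /2⌋ ≡⟨ cong ⌊_/2⌋ (+-suc i i) ⟩
  ⌈ i + i /2⌉     ≡⟨ +-cancelˡ-≡ i _ _ (trans (cong (_+ ⌈ i + i /2⌉) (n≡⌊n+n/2⌋ i)) (⌊n/2⌋+⌈n/2⌉≡n (i + i))) ⟩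
  i               ∎
  where open ≡-Reasoning

record Forces (G : Graph) (P : Subset (N G)) (u v : Fin (N G)) : Set where
  field
    forcer∈P  : u ∈ P
    adjacent  : Adj G u v
    target∉P  : v ∉ P
    others∈P  : ∀ w → Adj G u w → w ≢ v → w ∈ P

module Chronology {G : Graph} (adj? : ∀ u v → Dec (Adj G u v)) {L S : Subset (N G)}
                  (Inv : Subset (N G) → Set)
                  (inv-step : ∀ {P u v} → Inv P → Forces G P u v → Inv (P ∪ ⁅ v ⁆)) where

  Reaches : (Subset (N G) → Set) → Set
  Reaches Q = ∀ P → S ⊆ P → Inv P → ∃[ P′ ] P ⊆ P′ × Inv P′ × Q P′

  reaches-all : (ws : List (Fin (N G))) → (∀ {w} → w ∈ₗ ws → Reaches (w ∈_)) →
                Reaches (λ P′ → ∀ {w} → w ∈ₗ ws → w ∈ P′)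
  reaches-all []       _     P _   inv = P , (λ x∈P → x∈P) , inv , λ ()
  reaches-all (w ∷ ws) reach P S⊆P inv with reach (here refl) P S⊆P inv
  ... | P₁ , P⊆P₁ , inv₁ , w∈P₁ with reaches-all ws (reach ∘ there) P₁ (⊆-trans S⊆P P⊆P₁) inv₁
  ...   | P₂ , P₁⊆P₂ , inv₂ , ws⊆P₂ =
    P₂ , ⊆-trans P⊆P₁ P₁⊆P₂ , inv₂ , λ { (here refl) → P₁⊆P₂ w∈P₁ ; (there w∈ws) → ws⊆P₂ w∈ws }

  other-neighbour? : ∀ u v w → Dec (Adj G u w × w ≢ v)
  other-neighbour? u v w = adj? u w ×-dec ¬? (w ≟ᶠ v)

  -- The derivation of `Colored` is replayed force by force: before u forces v,
  -- every other neighbour of u is brought into the current set.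
  reaches-colored : ∀ {v} → Colored G L S v → Reaches (v ∈_)
  reaches-colored (initial v∈S) P S⊆P inv = P , (λ x∈P → x∈P) , inv , S⊆P v∈S
  reaches-colored (force {u} {v} _ colored-u u~v others) P S⊆P inv
    with reaches-colored colored-u P S⊆P inv
  ... | P₁ , P⊆P₁ , inv₁ , u∈P₁
    with reaches-all (filter (other-neighbour? u v) (allFin _))
           (λ w∈ → let (_ , u~w , w≢v) = ∈-filter⁻ (other-neighbour? u v) {xs = allFin _} w∈ in reaches-colored (others _ u~w w≢v))
           P₁ (⊆-trans S⊆P P⊆P₁) inv₁
  ...   | P₂ , P₁⊆P₂ , inv₂ , others⊆P₂ with v ∈? P₂
  ...     | yes v∈P₂ = P₂ , ⊆-trans P⊆P₁ P₁⊆P₂ , inv₂ , v∈P₂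
  ...     | no  v∉P₂ =
    P₂ ∪ ⁅ v ⁆ , (λ x∈P → x∈p∪q⁺ (inj₁ (P₁⊆P₂ (P⊆P₁ x∈P)))) ,
    inv-step inv₂ (record { forcer∈P = P₁⊆P₂ u∈P₁ ; adjacent = u~v ; target∉P = v∉P₂
                          ; others∈P = λ w u~w w≢v → others⊆P₂ (∈-filter⁺ (other-neighbour? u v) (∈-allFin w) (u~w , w≢v)) }) ,
    x∈p∪q⁺ (inj₂ (x∈⁅x⁆ v))

  invariant-on-everything : Inv S → (∀ v → Colored G L S v) → ∃[ P ] Inv P × (∀ v → v ∈ P)
  invariant-on-everything inv colored
    with reaches-all (allFin _) (λ {w} _ → reaches-colored (colored w)) S (λ x∈S → x∈S) inv
  ... | P , _ , invP , all∈P = P , invP , λ v → all∈P (∈-allFin v)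

Active : (G : Graph) → Subset (N G) → Fin (N G) → Set
Active G P a = a ∈ P × ∃[ b ] Adj G a b × b ∉ P

ActiveFamily : (G : Graph) → Subset (N G) → ℕ → Set
ActiveFamily G P k = ∃[ f ] Injective _≡_ _≡_ f × (∀ (i : Fin k) → Active G P (f i))

ActiveBoundedBy : (G : Graph) → Subset (N G) → ℕ → Set
ActiveBoundedBy G P c = ∀ {k} → ActiveFamily G P k → k ≤ c

activeBoundedBy-∣S∣ : ∀ {G} S → ActiveBoundedBy G S ∣ S ∣
activeBoundedBy-∣S∣ S (f , f-inj , f-active) = injective⇒≤∣p∣ S f f-inj (proj₁ ∘ f-active)

module _ {G : Graph} {P : Subset (N G)} {u v : Fin (N G)} (u→v : Forces G P u v) where
  open Forces u→v

  forcer-exit : ∀ {b} → Adj G u b → b ∉ P → b ≡ v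
  forcer-exit {b} u~b b∉P with b ≟ᶠ v
  ... | yes b≡v = b≡v
  ... | no  b≢v = ⊥-elim (b∉P (others∈P b u~b b≢v))

  forcer-inactive : ¬ Active G (P ∪ ⁅ v ⁆) u
  forcer-inactive (_ , b , u~b , b∉P∪⁅v⁆) =
    b∉P∪⁅v⁆ (subst (_∈ P ∪ ⁅ v ⁆) (sym (forcer-exit u~b (b∉P∪⁅v⁆ ∘ x∈p∪q⁺ ∘ inj₁))) (x∈p∪q⁺ (inj₂ (x∈⁅x⁆ v))))

  hand-over : Fin (N G) → Fin (N G)
  hand-over a with a ≟ᶠ v
  ... | yes _ = u
  ... | no  _ = a

  hand-over-active : ∀ {a} → Active G (P ∪ ⁅ v ⁆) a → Active G P (hand-over a)
  hand-over-active {a} (a∈ , b , a~b , b∉) with a ≟ᶠ v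
  ... | yes _   = forcer∈P , v , adjacent , target∉P
  ... | no  a≢v = x∈p∪⁅y⁆⁻ a∈ a≢v , b , a~b , b∉ ∘ x∈p∪q⁺ ∘ inj₁

  hand-over-injective : ∀ {a a′} → Active G (P ∪ ⁅ v ⁆) a → Active G (P ∪ ⁅ v ⁆) a′ →
                        hand-over a ≡ hand-over a′ → a ≡ a′
  hand-over-injective {a} {a′} act act′ eq with a ≟ᶠ v | a′ ≟ᶠ v
  ... | yes a≡v | yes a′≡v = trans a≡v (sym a′≡v)
  ... | no  _   | no  _    = eq
  ... | yes _   | no  _    = ⊥-elim (forcer-inactive (subst (Active G (P ∪ ⁅ v ⁆)) (sym eq) act′))
  ... | no  _   | yes _    = ⊥-elim (forcer-inactive (subst (Active G (P ∪ ⁅ v ⁆)) eq act))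

  activeBoundedBy-step : ∀ {c} → ActiveBoundedBy G P c → ActiveBoundedBy G (P ∪ ⁅ v ⁆) c
  activeBoundedBy-step bound (f , f-inj , f-active) =
    bound (hand-over ∘ f , f-inj ∘ hand-over-injective (f-active _) (f-active _) , hand-over-active ∘ f-active)

Consecutive : ℕ → ℕ → Set
Consecutive a b = suc a ≡ b ⊎ suc b ≡ a

consecutive? : ∀ a b → Dec (Consecutive a b)
consecutive? a b = (suc a ≟ b) ⊎-dec (suc b ≟ a)

path-adj? : ∀ n (x y : Fin n) → Dec (Adj (PathGraph n) x y)
path-adj? n x y = consecutive? (toℕ x) (toℕ y)

□-adj? : ∀ {G H} → (∀ x y → Dec (Adj G x y)) → (∀ x y → Dec (Adj H x y)) →
         ∀ a b → Dec (Adj (G □ H) a b)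
□-adj? {G} {H} G? H? a b =
  (proj₁ (remQuot {N G} (N H) a) ≟ᶠ proj₁ (remQuot {N G} (N H) b) ×-dec H? _ _) ⊎-dec
  (proj₂ (remQuot {N G} (N H) a) ≟ᶠ proj₂ (remQuot {N G} (N H) b) ×-dec G? _ _)

Neighbours : ℕ → ℕ → ℕ → ℕ → Set
Neighbours i j a b = (i ≡ a × Consecutive j b) ⊎ (j ≡ b × Consecutive i a)

neighbours-transpose : ∀ {i j a b} → Neighbours i j a b → Neighbours j i b a
neighbours-transpose (inj₁ p) = inj₂ p
neighbours-transpose (inj₂ p) = inj₁ p

module Grid (n : ℕ) where

  G : Graph
  G = PathGraph n □ PathGraph n

  V : Set
  V = Fin (n * n)

  reflect : ℕ → ℕ
  reflect a = n ∸ suc a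

  suc-reflect : ∀ {a} → a < n → suc (reflect a) ≡ n ∸ a
  suc-reflect a<n = sym (+-∸-assoc 1 a<n)

  reflect<n : ∀ {a} → a < n → reflect a < n
  reflect<n {a} a<n = subst (_≤ n) (sym (suc-reflect a<n)) (m∸n≤m n a)

  reflect-involutive : ∀ {a} → a < n → reflect (reflect a) ≡ a
  reflect-involutive a<n = trans (cong (n ∸_) (suc-reflect a<n)) (m∸[m∸n]≡n (<⇒≤ a<n))

  reflect-injective : ∀ {a b} → a < n → b < n → reflect a ≡ reflect b → a ≡ b
  reflect-injective a<n b<n e =
    trans (sym (reflect-involutive a<n)) (trans (cong reflect e) (reflect-involutive b<n))

  consecutive-reflect : ∀ {a b} → a < n → b < n → Consecutive a b → Consecutive (reflect a) (reflect b)
  consecutive-reflect a<n b<n (inj₁ refl) = inj₂ (suc-reflect b<n)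
  consecutive-reflect a<n b<n (inj₂ refl) = inj₁ (suc-reflect a<n)

  neighbours-reflect : ∀ {i j a b} → i < n → a < n →
                       Neighbours i j a b → Neighbours (reflect i) j (reflect a) b
  neighbours-reflect i<n a<n (inj₁ (refl , j~b)) = inj₁ (refl , j~b)
  neighbours-reflect i<n a<n (inj₂ (j≡b , i~a))  = inj₂ (j≡b , consecutive-reflect i<n a<n i~a)

  neighbours-unreflect : ∀ {i j a b} → i < n → a < n →
                         Neighbours (reflect i) j (reflect a) b → Neighbours i j a b
  neighbours-unreflect i<n a<n nb =
    subst₂ (λ i′ a′ → Neighbours i′ _ a′ _) (reflect-involutive i<n) (reflect-involutive a<n)
      (neighbours-reflect (reflect<n i<n) (reflect<n a<n) nb)

  -- A coordinate system on the grid; `transpose` and `flip` give the symmetric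
  -- ones, so that one sweep argument serves for every line direction.
  record Axes : Set where
    field
      row col          : V → ℕ
      row<n            : ∀ v → row v < n
      col<n            : ∀ v → col v < n
      cell             : ∀ {i j} → i < n → j < n → V
      row-cell         : ∀ {i j} (i<n : i < n) (j<n : j < n) → row (cell i<n j<n) ≡ i
      col-cell         : ∀ {i j} (i<n : i < n) (j<n : j < n) → col (cell i<n j<n) ≡ j
      coords-injective : ∀ {u v} → row u ≡ row v → col u ≡ col v → u ≡ v
      adj⇒neighbours   : ∀ {u v} → Adj G u v → Neighbours (row u) (col u) (row v) (col v)
      neighbours⇒adj   : ∀ {u v} → Neighbours (row u) (col u) (row v) (col v) → Adj G u v

  standard : Axes
  standard = record
    { row              = λ v → toℕ (proj₁ (remQuot {n} n v))
    ; col              = λ v → toℕ (proj₂ (remQuot {n} n v))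
    ; row<n            = λ _ → toℕ<n _
    ; col<n            = λ _ → toℕ<n _
    ; cell             = λ i<n j<n → combine {n} {n} (fromℕ< i<n) (fromℕ< j<n)
    ; row-cell         = λ i<n j<n → trans (cong (toℕ ∘ proj₁) (remQuot-combine {n} {n} (fromℕ< i<n) (fromℕ< j<n))) (toℕ-fromℕ< i<n)
    ; col-cell         = λ i<n j<n → trans (cong (toℕ ∘ proj₂) (remQuot-combine {n} {n} (fromℕ< i<n) (fromℕ< j<n))) (toℕ-fromℕ< j<n)
    ; coords-injective = λ {u} {v} e₁ e₂ → trans (sym (combine-remQuot {n} n u))
                           (trans (cong₂ (combine {n} {n}) (toℕ-injective e₁) (toℕ-injective e₂)) (combine-remQuot {n} n v))
    ; adj⇒neighbours   = λ { (inj₁ (e , j~b)) → inj₁ (cong toℕ e , j~b) ; (inj₂ (e , i~a)) → inj₂ (cong toℕ e , i~a) }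
    ; neighbours⇒adj   = λ { (inj₁ (e , j~b)) → inj₁ (toℕ-injective e , j~b) ; (inj₂ (e , i~a)) → inj₂ (toℕ-injective e , i~a) }
    }

  transpose : Axes → Axes
  transpose A = record
    { row              = col
    ; col              = row
    ; row<n            = col<n
    ; col<n            = row<n
    ; cell             = λ i<n j<n → cell j<n i<n
    ; row-cell         = λ i<n j<n → col-cell j<n i<n
    ; col-cell         = λ i<n j<n → row-cell j<n i<n
    ; coords-injective = λ e₁ e₂ → coords-injective e₂ e₁
    ; adj⇒neighbours   = neighbours-transpose ∘ adj⇒neighbours
    ; neighbours⇒adj   = neighbours⇒adj ∘ neighbours-transpose
    }
    where open Axes A

  flip : Axes → Axes
  flip A = record
    { row              = reflect ∘ row
    ; col              = col
    ; row<n            = reflect<n ∘ row<n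
    ; col<n            = col<n
    ; cell             = λ i<n j<n → cell (reflect<n i<n) j<n
    ; row-cell         = λ i<n j<n → trans (cong reflect (row-cell (reflect<n i<n) j<n)) (reflect-involutive i<n)
    ; col-cell         = λ i<n j<n → col-cell (reflect<n i<n) j<n
    ; coords-injective = λ e₁ e₂ → coords-injective (reflect-injective (row<n _) (row<n _) e₁) e₂
    ; adj⇒neighbours   = λ u~v → neighbours-reflect (row<n _) (row<n _) (adj⇒neighbours u~v)
    ; neighbours⇒adj   = λ nb → neighbours⇒adj (neighbours-unreflect (row<n _) (row<n _) nb)
    }
    where open Axes A

  -- Vacuously true when (i , j) lies off the grid.
  At : Axes → (V → Set) → ℕ → ℕ → Set
  At A Q i j = ∀ v → Axes.row A v ≡ i → Axes.col A v ≡ j → Q v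

  LeakAt : Axes → Subset (n * n) → ℕ → ℕ → Set
  LeakAt A L xa xb = ∀ u → u ∈ L → Axes.row A u ≡ xa × Axes.col A u ≡ xb

  leak-position : ∀ {L} → ∣ L ∣ ≤ 1 → ∃[ xa ] ∃[ xb ] LeakAt standard L xa xb
  leak-position {L} ∣L∣≤1 with nonempty? L
  ... | yes (ℓ , ℓ∈L) = row ℓ , col ℓ , λ u u∈L → let u≡ℓ = ∣p∣≤1⇒unique ∣L∣≤1 u∈L ℓ∈L in cong row u≡ℓ , cong col u≡ℓ
    where open Axes standard
  ... | no  L-empty   = 0 , 0 , λ u u∈L → ⊥-elim (L-empty (u , u∈L))

  Staircase : ℕ → ℕ → Set
  Staircase i j = (j ≡ i ⊎ j ≡ suc i) × i + j < n

  module Forcing (L S : Subset (n * n)) where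

    Cell : Axes → ℕ → ℕ → Set
    Cell A = At A (Colored G L S)

    Unleaked : Axes → ℕ → ℕ → Set
    Unleaked A = At A (_∉ L)

    -- In a sweep over the region R, (i , j) forces (1 + i , j): its other
    -- neighbours lie in R on lines i and i ∸ 1, which are already coloured.
    record Forcer (A : Axes) (R : ℕ → ℕ → Set) (i j : ℕ) : Set where
      field
        unleaked : Unleaked A i j
        self     : R i j
        right    : R i (suc j)
        left     : ∀ {b} → suc b ≡ j → R i b
        above    : ∀ {a} → suc a ≡ i → R a j

    module Sweep (A : Axes) (R : ℕ → ℕ → Set)
                 (first : ∀ {j} → R 0 j → Cell A 0 j)
                 (next  : ∀ {i j} → R (suc i) j → Cell A (suc i) j ⊎ Forcer A R i j) where
      open Axes A

      Line : ℕ → Set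
      Line i = ∀ {j} → R i j → Cell A i j

      force-below : ∀ {i j} → Forcer A R i j → Line i → (∀ {a} → suc a ≡ i → Line a) → Cell A (suc i) j
      force-below {i} {j} forcer line line-above v row≡ col≡ =
        force (unleaked u row-u col-u) (line self u row-u col-u) u~v others
        where
        open Forcer forcer
        i<n : i < n
        i<n = <-trans (n<1+n i) (subst (_< n) row≡ (row<n v))
        j<n : j < n
        j<n = subst (_< n) col≡ (col<n v)
        u : V
        u = cell i<n j<n
        row-u : row u ≡ i
        row-u = row-cell i<n j<n
        col-u : col u ≡ j
        col-u = col-cell i<n j<n
        u~v : Adj G u v
        u~v = neighbours⇒adj (inj₂ (trans col-u (sym col≡) , inj₁ (trans (cong suc row-u) (sym row≡))))
        others : ∀ w → Adj G u w → w ≢ v → Colored G L S w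
        others w u~w w≢v with subst₂ (λ a b → Neighbours a b (row w) (col w)) row-u col-u (adj⇒neighbours u~w)
        ... | inj₁ (i≡ , inj₁ 1+j≡) = line right w (sym i≡) (sym 1+j≡)
        ... | inj₁ (i≡ , inj₂ 1+c≡) = line (left 1+c≡) w (sym i≡) refl
        ... | inj₂ (j≡ , inj₁ 1+i≡) = ⊥-elim (w≢v (coords-injective (trans (sym 1+i≡) (sym row≡)) (trans (sym j≡) (sym col≡))))
        ... | inj₂ (j≡ , inj₂ 1+r≡) = line-above 1+r≡ (above 1+r≡) w refl (sym j≡)

      line-next : ∀ {i} → Line i → (∀ {a} → suc a ≡ i → Line a) → Line (suc i)
      line-next line line-above R[1+i,j] with next R[1+i,j]
      ... | inj₁ coloured = coloured
      ... | inj₂ forcer   = force-below forcer line line-above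

      lines : ∀ i → Line i × Line (suc i)
      lines zero    = first , line-next first (λ ())
      lines (suc i) = proj₂ (lines i) , line-next (proj₂ (lines i)) (λ { refl → proj₁ (lines i) })

      sweep : ∀ {i j} → R i j → Cell A i j
      sweep {i} = proj₁ (lines i)

    module _ (A : Axes) where
      open Axes A

      upper-from-top-row : (∀ {i j} → i < j → Unleaked A i j) → (∀ {j} → Cell A 0 j) →
                           ∀ {i j} → i ≤ j → Cell A i j
      upper-from-top-row unleaked top = Sweep.sweep A _≤_ (λ _ → top) next
        where
        next : ∀ {i j} → suc i ≤ j → Cell A (suc i) j ⊎ Forcer A _≤_ i j
        next 1+i≤j = inj₂ record
          { unleaked = unleaked 1+i≤j
          ; self     = <⇒≤ 1+i≤j
          ; right    = m≤n⇒m≤1+n (<⇒≤ 1+i≤j)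
          ; left     = λ { refl → s≤s⁻¹ 1+i≤j }
          ; above    = λ { refl → <⇒≤ (<-trans (n<1+n _) 1+i≤j) }
          }

      unleaked-off : ∀ {xa xb i j} → LeakAt A L xa xb → ¬ (i ≡ xa × j ≡ xb) → Unleaked A i j
      unleaked-off leak off u row≡ col≡ u∈L =
        off (trans (sym row≡) (proj₁ (leak u u∈L)) , trans (sym col≡) (proj₂ (leak u u∈L)))

      -- Rows above the leak are swept downwards; below it, columns are swept
      -- leftwards from the last one, which lies in the upper triangle.
      colored-from-upper : ∀ {xa xb} → LeakAt A L xa xb →
                           (∀ {i j} → i ≤ j → Cell A i j) → ∀ v → Colored G L S v
      colored-from-upper {xa} leak upper v =
        Sweep.sweep (flip (transpose A)) (λ _ _ → ⊤) last-column column-next tt v refl refl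
        where
        top-rows : ∀ {i j} → i ≤ xa → Cell A i j
        top-rows = Sweep.sweep A (λ i _ → i ≤ xa) (λ _ → upper z≤n) λ 1+i≤xa → inj₂ record
          { unleaked = unleaked-off leak (λ (i≡xa , _) → <-irrefl i≡xa 1+i≤xa)
          ; self     = <⇒≤ 1+i≤xa
          ; right    = <⇒≤ 1+i≤xa
          ; left     = λ _ → <⇒≤ 1+i≤xa
          ; above    = λ { refl → <⇒≤ (<-trans (n<1+n _) 1+i≤xa) }
          }
        last-column : ∀ {j} → ⊤ → Cell (flip (transpose A)) 0 j
        last-column _ w reflect-col≡0 _ =
          upper (s≤s⁻¹ (≤-trans (row<n w) (m∸n≡0⇒m≤n reflect-col≡0))) w refl refl
        column-next : ∀ {i j} → ⊤ → Cell (flip (transpose A)) (suc i) j ⊎ Forcer (flip (transpose A)) (λ _ _ → ⊤) i j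
        column-next {j = j} _ with j ≤? xa
        ... | yes j≤xa = inj₁ λ w _ row≡ → top-rows (subst (_≤ xa) (sym row≡) j≤xa) w refl refl
        ... | no  j≰xa = inj₂ record
          { unleaked = λ u _ row≡ u∈L → j≰xa (≤-reflexive (trans (sym row≡) (proj₁ (leak u u∈L))))
          ; self = tt ; right = tt ; left = λ _ → tt ; above = λ _ → tt
          }

      -- Both waves sweep the triangle below the antidiagonal column by column;
      -- the cells next to the diagonal, which no step can force, are seeds.
      wave-superdiagonal : (∀ {i j} → Staircase i j → Cell A i j) → (∀ {i j} → i < j → Unleaked A i j) →
                           ∀ {j} → Cell A 0 j
      wave-superdiagonal seed unleaked w row≡ col≡ =
        Sweep.sweep (transpose A) R first next (z≤n , subst (_< n) col≡ (col<n w)) w col≡ row≡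
        where
        R : ℕ → ℕ → Set
        R p q = q ≤ p × q + p < n
        first : ∀ {q} → R 0 q → Cell (transpose A) 0 q
        first (z≤n , 0<n) u col≡ row≡ = seed (inj₁ refl , 0<n) u row≡ col≡
        next : ∀ {p q} → R (suc p) q → Cell (transpose A) (suc p) q ⊎ Forcer (transpose A) R p q
        next {p} {q} (q≤1+p , q+1+p<n) with m≤n⇒m<n∨m≡n q≤1+p
        ... | inj₂ refl = inj₁ λ u col≡ row≡ → seed (inj₁ refl , q+1+p<n) u row≡ col≡
        ... | inj₁ q<1+p with m≤n⇒m<n∨m≡n (s≤s⁻¹ q<1+p)
        ...   | inj₂ refl = inj₁ λ u col≡ row≡ → seed (inj₂ refl , q+1+p<n) u row≡ col≡
        ...   | inj₁ q<p  = inj₂ record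
          { unleaked = λ u col≡ row≡ → unleaked q<p u row≡ col≡
          ; self     = <⇒≤ q<p , sum<n ≤-refl (n≤1+n p)
          ; right    = q<p , subst (_< n) (+-suc q p) q+1+p<n
          ; left     = λ { refl → ≤-trans (n≤1+n _) (<⇒≤ q<p) , sum<n (n≤1+n _) (n≤1+n p) }
          ; above    = λ { refl → s≤s⁻¹ q<p , sum<n ≤-refl (≤-trans (n≤1+n _) (n≤1+n _)) }
          }
          where
          sum<n : ∀ {a b} → a ≤ q → b ≤ suc p → a + b < n
          sum<n a≤q b≤1+p = ≤-<-trans (+-mono-≤ a≤q b≤1+p) q+1+p<n

      wave-subdiagonal : (∀ {i j} → Staircase j i → Cell A i j) → (∀ {i j} → i ≤ j → Unleaked A i j) →
                         ∀ {j} → Cell A 0 j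
      wave-subdiagonal seed unleaked w row≡ col≡ =
        Sweep.sweep (transpose A) R first next (z≤n , subst (_< n) col≡ (col<n w)) w col≡ row≡
        where
        R : ℕ → ℕ → Set
        R p q = q ≤ suc p × q + p < n
        first : ∀ {q} → R 0 q → Cell (transpose A) 0 q
        first (z≤n     , 0<n) u col≡ row≡ = seed (inj₁ refl , 0<n) u row≡ col≡
        first (s≤s z≤n , 1<n) u col≡ row≡ = seed (inj₂ refl , 1<n) u row≡ col≡
        next : ∀ {p q} → R (suc p) q → Cell (transpose A) (suc p) q ⊎ Forcer (transpose A) R p q
        next {p} {q} (q≤2+p , q+1+p<n) with m≤n⇒m<n∨m≡n q≤2+p
        ... | inj₂ refl =
          inj₁ λ u col≡ row≡ → seed (inj₂ refl , subst (_< n) (+-comm q (suc p)) q+1+p<n) u row≡ col≡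
        ... | inj₁ q<2+p with m≤n⇒m<n∨m≡n (s≤s⁻¹ q<2+p)
        ...   | inj₂ refl = inj₁ λ u col≡ row≡ → seed (inj₁ refl , q+1+p<n) u row≡ col≡
        ...   | inj₁ q<1+p = inj₂ record
          { unleaked = λ u col≡ row≡ → unleaked (s≤s⁻¹ q<1+p) u row≡ col≡
          ; self     = <⇒≤ q<1+p , sum<n ≤-refl (n≤1+n p)
          ; right    = q<1+p , subst (_< n) (+-suc q p) q+1+p<n
          ; left     = λ { refl → ≤-trans (n≤1+n _) (<⇒≤ q<1+p) , sum<n (n≤1+n _) (n≤1+n p) }
          ; above    = λ { refl → s≤s⁻¹ q<1+p , sum<n ≤-refl (≤-trans (n≤1+n _) (n≤1+n _)) }
          }
          where
          sum<n : ∀ {a b} → a ≤ q → b ≤ suc p → a + b < n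
          sum<n a≤q b≤1+p = ≤-<-trans (+-mono-≤ a≤q b≤1+p) q+1+p<n

    colored-from-staircase : (∀ {v} → Staircase (Axes.row standard v) (Axes.col standard v) → v ∈ S) →
                             ∀ {xa xb} → LeakAt standard L xa xb → ∀ v → Colored G L S v
    colored-from-staircase staircase⊆S {xa} {xb} leak with xb ≤? xa
    ... | yes xb≤xa = colored-from-upper standard leak
                        (upper-from-top-row standard strict (wave-superdiagonal standard seed strict))
      where
      strict : ∀ {i j} → i < j → Unleaked standard i j
      strict i<j = unleaked-off standard leak (λ { (refl , refl) → ≤⇒≯ xb≤xa i<j })
      seed : ∀ {i j} → Staircase i j → Cell standard i j
      seed st v row≡ col≡ = initial (staircase⊆S (subst₂ Staircase (sym row≡) (sym col≡) st))
    ... | no  xb≰xa = colored-from-upper (transpose standard) leakᵀ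
                        (upper-from-top-row (transpose standard) (weak ∘ <⇒≤) (wave-subdiagonal (transpose standard) seed weak))
      where
      leakᵀ : LeakAt (transpose standard) L xb xa
      leakᵀ u u∈L = Product.swap (leak u u∈L)
      weak : ∀ {i j} → i ≤ j → Unleaked (transpose standard) i j
      weak i≤j = unleaked-off (transpose standard) leakᵀ (λ { (refl , refl) → xb≰xa i≤j })
      seed : ∀ {i j} → Staircase j i → Cell (transpose standard) i j
      seed st v col≡ row≡ = initial (staircase⊆S (subst₂ Staircase (sym row≡) (sym col≡) st))

  staircase? : ∀ i j → Dec (Staircase i j)
  staircase? i j = ((j ≟ i) ⊎-dec (j ≟ suc i)) ×-dec (suc (i + j) ≤? n)

  module _ where
    open Axes standard

    on-staircase? : Decidable (λ v → Staircase (row v) (col v))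
    on-staircase? v = staircase? (row v) (col v)

    staircase : Subset (n * n)
    staircase = subset on-staircase?

    staircase-1-forcing : IsLeakyForcingSet G 1 staircase
    staircase-1-forcing L ∣L∣≤1 =
      let (_ , _ , leak) = leak-position ∣L∣≤1 in
      Forcing.colored-from-staircase L staircase (∈-subset⁺ on-staircase?) leak

    ⌊k/2⌋<n : ∀ (k : Fin n) → ⌊ toℕ k /2⌋ < n
    ⌊k/2⌋<n k = ≤-<-trans (⌊n/2⌋≤n (toℕ k)) (toℕ<n k)

    ⌈k/2⌉<n : ∀ (k : Fin n) → ⌈ toℕ k /2⌉ < n
    ⌈k/2⌉<n k = ≤-<-trans (⌈n/2⌉≤n (toℕ k)) (toℕ<n k)

    staircase-cell : Fin n → V
    staircase-cell k = cell (⌊k/2⌋<n k) (⌈k/2⌉<n k)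

    row-staircase-cell : ∀ k → row (staircase-cell k) ≡ ⌊ toℕ k /2⌋
    row-staircase-cell k = row-cell (⌊k/2⌋<n k) (⌈k/2⌉<n k)

    col-staircase-cell : ∀ k → col (staircase-cell k) ≡ ⌈ toℕ k /2⌉
    col-staircase-cell k = col-cell (⌊k/2⌋<n k) (⌈k/2⌉<n k)

    ∣staircase∣≡n : ∣ staircase ∣ ≡ n
    ∣staircase∣≡n = ≤-antisym (covered⇒∣p∣≤ staircase staircase-cell covered)
                              (injective⇒≤∣p∣ staircase staircase-cell injective ∈staircase)
      where
      row+col : ∀ k → row (staircase-cell k) + col (staircase-cell k) ≡ toℕ k
      row+col k = trans (cong₂ _+_ (row-staircase-cell k) (col-staircase-cell k)) (⌊n/2⌋+⌈n/2⌉≡n (toℕ k))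
      injective : Injective _≡_ _≡_ staircase-cell
      injective {k} {l} e = toℕ-injective (trans (sym (row+col k)) (trans (cong (λ v → row v + col v) e) (row+col l)))
      ∈staircase : ∀ k → staircase-cell k ∈ staircase
      ∈staircase k = ∈-subset⁺ on-staircase?
        ( subst₂ (λ i j → j ≡ i ⊎ j ≡ suc i) (sym (row-staircase-cell k)) (sym (col-staircase-cell k))
                 (⌈n/2⌉≡⌊n/2⌋⊎1+⌊n/2⌋ (toℕ k))
        , subst (_< n) (sym (row+col k)) (toℕ<n k))
      covered : ∀ {v} → v ∈ staircase → ∃[ k ] staircase-cell k ≡ v
      covered {v} v∈ with ∈-subset⁻ on-staircase? v∈
      ... | diag , sum<n = k , coords-injective row≡ col≡
        where
        k : Fin n
        k = fromℕ< sum<n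
        row≡ : row (staircase-cell k) ≡ row v
        row≡ = trans (row-staircase-cell k) (trans (cong ⌊_/2⌋ (toℕ-fromℕ< sum<n)) (⌊i+j/2⌋≡i (row v) diag))
        col≡ : col (staircase-cell k) ≡ col v
        col≡ = +-cancelˡ-≡ (row (staircase-cell k)) _ _
                 (trans (row+col k) (trans (toℕ-fromℕ< sum<n) (cong (_+ col v) (sym row≡))))

  adj? : ∀ u v → Dec (Adj G u v)
  adj? = □-adj? {PathGraph n} {PathGraph n} (path-adj? n) (path-adj? n)

  FullRow : Axes → Subset (n * n) → ℕ → Set
  FullRow A P x = ∀ w → Axes.row A w ≡ x → w ∈ P

  HasFullRow : Axes → Subset (n * n) → Set
  HasFullRow A P = ∃[ w ] FullRow A P (Axes.row A w)

  hasFullRow? : ∀ A P → Dec (HasFullRow A P)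
  hasFullRow? A P = any? λ w → all? λ w′ → (row w′ ≟ row w) →-dec (w′ ∈? P)
    where open Axes A

  missing-from-row : ∀ A {P x} → ¬ FullRow A P x → ∃[ z ] Axes.row A z ≡ x × z ∉ P
  missing-from-row A {P} {x} not-full with ¬∀⟶∃¬ (n * n) _ (λ w → (Axes.row A w ≟ x) →-dec (w ∈? P)) not-full
  ... | z , ¬[row≡⇒∈] = z , decidable-stable (Axes.row A z ≟ x) (λ row≢ → ¬[row≡⇒∈] (⊥-elim ∘ row≢)) , ¬[row≡⇒∈] ∘ const

  module Lines (A : Axes) where
    open Axes A

    at-cell : ∀ {Q i j} (i<n : i < n) (j<n : j < n) → At A Q i j → Q (cell i<n j<n)
    at-cell i<n j<n at = at _ (row-cell i<n j<n) (col-cell i<n j<n)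

    cell-at : ∀ {Q i j} (i<n : i < n) (j<n : j < n) → Q (cell i<n j<n) → At A Q i j
    cell-at {Q} i<n j<n q v refl refl = subst Q (coords-injective (row-cell i<n j<n) (col-cell i<n j<n)) q

    hasFullRow⇒n≤∣P∣ : ∀ {P} → HasFullRow A P → n ≤ ∣ P ∣
    hasFullRow⇒n≤∣P∣ {P} (w , full) = injective⇒≤∣p∣ P in-row injective (λ y → full (in-row y) (row-cell _ _))
      where
      in-row : Fin n → V
      in-row y = cell (row<n w) (toℕ<n y)
      injective : Injective _≡_ _≡_ in-row
      injective {y₁} {y₂} e = toℕ-injective (trans (sym (col-cell _ _)) (trans (cong col e) (col-cell _ _)))

    ColumnExit : Subset (n * n) → ℕ → Set
    ColumnExit P y = ∃[ a ] ∃[ b ] col a ≡ y × col b ≡ y × a ∈ P × Adj G a b × b ∉ P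

    module _ {P : Subset (n * n)} {y : ℕ} where

      In : ℕ → Set
      In t = At A (_∈ P) t y

      In? : Decidable In
      In? t = all? λ v → (row v ≟ t) →-dec ((col v ≟ y) →-dec (v ∈? P))

      exit-between : ∀ {i j} (i<n : i < n) (j<n : j < n) (y<n : y < n) →
                     In i → ¬ In j → Consecutive i j → ColumnExit P y
      exit-between i<n j<n y<n In-i ¬In-j i~j =
        cell i<n y<n , cell j<n y<n , col-cell _ _ , col-cell _ _ , at-cell i<n y<n In-i ,
        neighbours⇒adj (inj₂ (trans (col-cell _ _) (sym (col-cell _ _)) ,
                              subst₂ Consecutive (sym (row-cell _ _)) (sym (row-cell _ _)) i~j)) ,
        ¬In-j ∘ cell-at j<n y<n

      column-exit : ∀ {w z} → col w ≡ y → w ∈ P → col z ≡ y → z ∉ P → ColumnExit P y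
      column-exit {w} {z} col-w w∈P col-z z∉P = walk (≤-total (row w) (row z))
        where
        y<n : y < n
        y<n = subst (_< n) col-w (col<n w)
        In-w : In (row w)
        In-w = cell-at (row<n w) y<n (subst (_∈ P) (coords-injective (sym (row-cell _ _)) (trans col-w (sym (col-cell _ _)))) w∈P)
        ¬In-z : ¬ In (row z)
        ¬In-z In-z = z∉P (In-z z refl col-z)
        walk : row w ≤ row z ⊎ row z ≤ row w → ColumnExit P y
        walk (inj₁ w≤z) =
          let (t , t<z , In-t , ¬In-1+t) = crossing In? w≤z In-w ¬In-z in
          exit-between (<-trans t<z (row<n z)) (≤-<-trans t<z (row<n z)) y<n In-t ¬In-1+t (inj₁ refl)
        walk (inj₂ z≤w) =
          let (t , t<w , ¬In-t , ¬¬In-1+t) = crossing (¬? ∘ In?) z≤w ¬In-z (λ ¬In-w → ¬In-w In-w) in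
          exit-between (≤-<-trans t<w (row<n w)) (<-trans t<w (row<n w)) y<n
                       (decidable-stable (In? (suc t)) ¬¬In-1+t) ¬In-t (inj₂ refl)

    -- The exits of the columns other than v's are distinct from each other and
    -- from u, whose only exit is v.
    completing-row⇒activeFamily : ∀ {P u v x} → Forces G P u v → ¬ HasFullRow (transpose A) P →
                                  x < n → FullRow A (P ∪ ⁅ v ⁆) x → ActiveFamily G P n
    completing-row⇒activeFamily {P} {u} {v} {x} u→v no-full-column x<n row-full =
      exit , exit-injective , exit-active
      where
      open Forces u→v
      exit-of : ∀ (y : Fin n) → toℕ y ≢ col v → ColumnExit P (toℕ y)
      exit-of y y≢col-v =
        let (z , col-z , z∉P) = missing-from-column in column-exit (col-cell _ _) w∈P col-z z∉P
        where
        w : V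
        w = cell x<n (toℕ<n y)
        w∈P : w ∈ P
        w∈P = x∈p∪⁅y⁆⁻ (row-full w (row-cell _ _)) (λ w≡v → y≢col-v (trans (sym (col-cell _ _)) (cong col w≡v)))
        missing-from-column : ∃[ z ] col z ≡ toℕ y × z ∉ P
        missing-from-column =
          missing-from-row (transpose A) (λ full → no-full-column (w , subst (FullRow (transpose A) P) (sym (col-cell _ _)) full))
      exit : Fin n → V
      exit y with toℕ y ≟ col v
      ... | yes _      = u
      ... | no  y≢col-v = proj₁ (exit-of y y≢col-v)
      exit-active : ∀ y → Active G P (exit y)
      exit-active y with toℕ y ≟ col v
      ... | yes _      = forcer∈P , v , adjacent , target∉P
      ... | no  y≢col-v = let (_ , b , _ , _ , a∈P , a~b , b∉P) = exit-of y y≢col-v in a∈P , b , a~b , b∉P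
      only-exit : ∀ y (y≢col-v : toℕ y ≢ col v) → proj₁ (exit-of y y≢col-v) ≡ u → toℕ y ≡ col v
      only-exit y y≢col-v a≡u =
        let (_ , b , _ , col-b , _ , a~b , b∉P) = exit-of y y≢col-v in
        trans (sym col-b) (cong col (forcer-exit u→v (subst (λ a → Adj G a b) a≡u a~b) b∉P))
      exit-injective : Injective _≡_ _≡_ exit
      exit-injective {y₁} {y₂} eq with toℕ y₁ ≟ col v | toℕ y₂ ≟ col v
      ... | yes y₁≡ | yes y₂≡ = toℕ-injective (trans y₁≡ (sym y₂≡))
      ... | no  y₁≢ | no  y₂≢ =
        let (_ , _ , col-a₁ , _) = exit-of y₁ y₁≢ ; (_ , _ , col-a₂ , _) = exit-of y₂ y₂≢ in
        toℕ-injective (trans (sym col-a₁) (trans (cong col eq) col-a₂))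
      ... | yes _   | no  y₂≢ = ⊥-elim (y₂≢ (only-exit y₂ y₂≢ (sym eq)))
      ... | no  y₁≢ | yes _   = ⊥-elim (y₁≢ (only-exit y₁ y₁≢ eq))

  HasFullLine : Subset (n * n) → Set
  HasFullLine P = HasFullRow standard P ⊎ HasFullRow (transpose standard) P

  Invariant : Subset (n * n) → Subset (n * n) → Set
  Invariant S P = ActiveBoundedBy G P ∣ S ∣ × (HasFullLine P → n ≤ ∣ S ∣)

  invariant-initial : ∀ S → Invariant S S
  invariant-initial S =
    activeBoundedBy-∣S∣ {G} S , Sum.[ Lines.hasFullRow⇒n≤∣P∣ standard , Lines.hasFullRow⇒n≤∣P∣ (transpose standard) ]

  invariant-step : ∀ {S P u v} → Invariant S P → Forces G P u v → Invariant S (P ∪ ⁅ v ⁆)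
  invariant-step {S} {P} {u} {v} (bound , full⇒) u→v = activeBoundedBy-step u→v bound , full′⇒
    where
    full′⇒ : HasFullLine (P ∪ ⁅ v ⁆) → n ≤ ∣ S ∣
    full′⇒ full′ with hasFullRow? standard P ⊎-dec hasFullRow? (transpose standard) P
    ... | yes full = full⇒ full
    ... | no  no-full with full′
    ...   | inj₁ (w , full-row) = bound (Lines.completing-row⇒activeFamily standard u→v
                                           (no-full ∘ inj₂) (Axes.row<n standard w) full-row)
    ...   | inj₂ (w , full-col) = bound (Lines.completing-row⇒activeFamily (transpose standard) u→v
                                           (no-full ∘ inj₁) (Axes.col<n standard w) full-col)

  zero-forcing-lower-bound : ∀ {L S} → 0 < n → (∀ v → Colored G L S v) → n ≤ ∣ S ∣
  zero-forcing-lower-bound {S = S} 0<n colored =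
    let (P , (_ , full⇒) , all∈P) =
          Chronology.invariant-on-everything adj? (Invariant S) (invariant-step {S}) (invariant-initial S) colored
    in full⇒ (inj₁ (Axes.cell standard 0<n 0<n , λ w _ → all∈P w))

corollary32 : ∀ (n : ℕ) → 1 ≤ n → ZLeak≡ (PathGraph n □ PathGraph n) 1 n
corollary32 n 1≤n =
  (staircase , staircase-1-forcing , ∣staircase∣≡n) ,
  λ S S-forcing → zero-forcing-lower-bound 1≤n (S-forcing ⊥ (≤-trans (≤-reflexive (∣⊥∣≡0 (n * n))) z≤n))
  where open Grid n
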